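{- Let $R$ be a proposition rewrite system and $A$ a closed proposition containing no predicate or function symbol appearing in $R$. If the sequent $\Gamma\vdash\Delta$ has a proof (possibly with cuts) in the classical sequent calculus modulo $R$, then the sequent $\Gamma^A,\ \Delta^A\Rightarrow A\vdash A$ has a proof (possibly with cuts) in the intuitionistic sequent calculus modulo $R^A$, where $\Gamma^A=\{G^A\mid G\in\Gamma\}$ and $\Delta^A\Rightarrow A=\{D^A\Rightarrow A\mid D\in\Delta\}$.
   Context: Propositions are first-order with connectives $\wedge,\vee,\Rightarrow,\top,\bot$ and quantifiers $\forall,\exists$. A proposition rewrite system is an orthogonal set of rules $P\to F$ with $P$ atomic and $FV(F)\subseteq FV(P)$; it generates a congruence $\equiv$. Writing $\neg_A X:=(X\Rightarrow A)\Rightarrow A$, the $A$-translation is: $B^A=B$ for atomic $B$; $\top^A=\top$; $\bot^A=\bot$; $(B\circ C)^A=\neg_A B^A\circ\neg_A C^A$ for $\circ\in\{\Rightarrow,\wedge,\vee\}$; $(Qx B)^A=Qx\,\neg_A B^A$ for $Q\in\{\forall,\exists\}$; for $R=\{P_i\to F_i\}$, $R^A=\{P_i\to F_i^A\}$. The classical sequent calculus modulo a rewrite system is Gentzen's LK with left/right logical rules for all connectives and quantifiers, left/right contraction and weakening, the axiom $A\vdash B$ for $A\equiv B$, and cut with premises $\Gamma\vdash A,\Delta$ and $\Gamma,B\vdash\Delta$ for $A\equiv B$; each logical rule (and contraction) may be applied to any formula congruent to the shape it requires ($\bot$-left: $A\vdash$ for $A\equiv\bot$; $\top$-right: $\vdash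 A$ for $A\equiv\top$). The intuitionistic sequent calculus modulo is the same system with at most one formula on the right of sequents: the $\vee$-right rule is replaced by two rules $\vee_1,\vee_2$ deriving $\Gamma\vdash C$ from $\Gamma\vdash A$ (resp. $\Gamma\vdash B$) for $C\equiv A\vee B$, and the $\Rightarrow$-left rule has right premise $\Gamma\vdash A$ (with $C\equiv A\Rightarrow B$ and left premise $\Gamma,B\vdash\Delta$). -}

module Defs where

open import Data.Nat using (ℕ; zero; suc; _+_; _≤_)
open import Data.List using (List; []; _∷_; [_]; map; _++_)
open import Data.Maybe using (Maybe; just; nothing) renaming (map to mapMaybe)
open import Data.Product using (_×_; _,_)
open import Data.Sum using (_⊎_)
open import Data.Empty using (⊥)
open import Relation.Nullary using (¬_)
open import Relation.Binary.PropositionalEquality using (_≡_; _≢_)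
open import Relation.Binary.Construct.Closure.Equivalence using (EqClosure)
open import Data.List.Relation.Binary.Permutation.Propositional using (_↭_)

-- First-order syntax (de Bruijn indices for variables; function and
-- predicate symbols are natural numbers, applied to lists of terms).

data Term : Set where
  var : ℕ → Term
  fun : ℕ → List Term → Term

infixr 5 _⇒_
infixr 6 _∨_
infixr 7 _∧_

data Formula : Set where
  atom : ℕ → List Term → Formula
  ⊤ᶠ ⊥ᶠ : Formula
  _⇒_ _∧_ _∨_ : Formula → Formula → Formula
  allF exF : Formula → Formula     -- binds de Bruijn index 0

ext : (ℕ → ℕ) → ℕ → ℕ
ext ρ zero = zero
ext ρ (suc n) = suc (ρ n)

mutual
  renT : (ℕ → ℕ) → Term → Term
  renT ρ (var x) = var (ρ x)
  renT ρ (fun f ts) = fun f (renTs ρ ts)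

  renTs : (ℕ → ℕ) → List Term → List Term
  renTs ρ [] = []
  renTs ρ (t ∷ ts) = renT ρ t ∷ renTs ρ ts

lift : (ℕ → Term) → ℕ → Term
lift σ zero = var zero
lift σ (suc n) = renT suc (σ n)

mutual
  substT : (ℕ → Term) → Term → Term
  substT σ (var x) = σ x
  substT σ (fun f ts) = fun f (substTs σ ts)

  substTs : (ℕ → Term) → List Term → List Term
  substTs σ [] = []
  substTs σ (t ∷ ts) = substT σ t ∷ substTs σ ts

renF : (ℕ → ℕ) → Formula → Formula
renF ρ (atom p ts) = atom p (renTs ρ ts)
renF ρ ⊤ᶠ = ⊤ᶠ
renF ρ ⊥ᶠ = ⊥ᶠ
renF ρ (A ⇒ B) = renF ρ A ⇒ renF ρ B
renF ρ (A ∧ B) = renF ρ A ∧ renF ρ B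
renF ρ (A ∨ B) = renF ρ A ∨ renF ρ B
renF ρ (allF A) = allF (renF (ext ρ) A)
renF ρ (exF A) = exF (renF (ext ρ) A)

substF : (ℕ → Term) → Formula → Formula
substF σ (atom p ts) = atom p (substTs σ ts)
substF σ ⊤ᶠ = ⊤ᶠ
substF σ ⊥ᶠ = ⊥ᶠ
substF σ (A ⇒ B) = substF σ A ⇒ substF σ B
substF σ (A ∧ B) = substF σ A ∧ substF σ B
substF σ (A ∨ B) = substF σ A ∨ substF σ B
substF σ (allF A) = allF (substF (lift σ) A)
substF σ (exF A) = exF (substF (lift σ) A)

shift : Formula → Formula
shift = renF suc

single : Term → ℕ → Term
single t zero = t
single t (suc n) = var n

inst : Formula → Term → Formula
inst A t = substF (single t) A

mutual
  data FreeT (x : ℕ) : Term → Set where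
    here : FreeT x (var x)
    inFun : ∀ {f ts} → FreeTs x ts → FreeT x (fun f ts)

  data FreeTs (x : ℕ) : List Term → Set where
    hd : ∀ {t ts} → FreeT x t → FreeTs x (t ∷ ts)
    tl : ∀ {t ts} → FreeTs x ts → FreeTs x (t ∷ ts)

data FreeF : ℕ → Formula → Set where
  atom : ∀ {x p ts} → FreeTs x ts → FreeF x (atom p ts)
  ⇒l : ∀ {x A B} → FreeF x A → FreeF x (A ⇒ B)
  ⇒r : ∀ {x A B} → FreeF x B → FreeF x (A ⇒ B)
  ∧l : ∀ {x A B} → FreeF x A → FreeF x (A ∧ B)
  ∧r : ∀ {x A B} → FreeF x B → FreeF x (A ∧ B)
  ∨l : ∀ {x A B} → FreeF x A → FreeF x (A ∨ B)
  ∨r : ∀ {x A B} → FreeF x B → FreeF x (A ∨ B)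
  allF : ∀ {x A} → FreeF (suc x) A → FreeF x (allF A)
  exF : ∀ {x A} → FreeF (suc x) A → FreeF x (exF A)

Closed : Formula → Set
Closed A = ∀ x → ¬ FreeF x A

mutual
  data FunT (f : ℕ) : Term → Set where
    here : ∀ {ts} → FunT f (fun f ts)
    arg : ∀ {g ts} → FunTs f ts → FunT f (fun g ts)

  data FunTs (f : ℕ) : List Term → Set where
    hd : ∀ {t ts} → FunT f t → FunTs f (t ∷ ts)
    tl : ∀ {t ts} → FunTs f ts → FunTs f (t ∷ ts)

data FunF (f : ℕ) : Formula → Set where
  atom : ∀ {p ts} → FunTs f ts → FunF f (atom p ts)
  ⇒l : ∀ {A B} → FunF f A → FunF f (A ⇒ B)
  ⇒r : ∀ {A B} → FunF f B → FunF f (A ⇒ B)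
  ∧l : ∀ {A B} → FunF f A → FunF f (A ∧ B)
  ∧r : ∀ {A B} → FunF f B → FunF f (A ∧ B)
  ∨l : ∀ {A B} → FunF f A → FunF f (A ∨ B)
  ∨r : ∀ {A B} → FunF f B → FunF f (A ∨ B)
  allF : ∀ {A} → FunF f A → FunF f (allF A)
  exF : ∀ {A} → FunF f A → FunF f (exF A)

data PredF (p : ℕ) : Formula → Set where
  atom : ∀ {ts} → PredF p (atom p ts)
  ⇒l : ∀ {A B} → PredF p A → PredF p (A ⇒ B)
  ⇒r : ∀ {A B} → PredF p B → PredF p (A ⇒ B)
  ∧l : ∀ {A B} → PredF p A → PredF p (A ∧ B)
  ∧r : ∀ {A B} → PredF p B → PredF p (A ∧ B)
  ∨l : ∀ {A B} → PredF p A → PredF p (A ∨ B)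
  ∨r : ∀ {A B} → PredF p B → PredF p (A ∨ B)
  allF : ∀ {A} → PredF p A → PredF p (allF A)
  exF : ∀ {A} → PredF p A → PredF p (exF A)

mutual
  occT : ℕ → Term → ℕ
  occT x (var y) with x Data.Nat.≟ y
  ... | Relation.Nullary.yes _ = 1
  ... | Relation.Nullary.no _ = 0
  occT x (fun f ts) = occTs x ts

  occTs : ℕ → List Term → ℕ
  occTs x [] = 0
  occTs x (t ∷ ts) = occT x t + occTs x ts

-- Proposition rewrite systems (a possibly infinite set of rules P → F,
-- indexed by Idx, with P atomic by construction)

record RewriteSystem : Set₁ where
  field
    Idx : Set
    lhsSym : Idx → ℕ
    lhsArgs : Idx → List Term
    rhs : Idx → Formula

  lhs : Idx → Formula
  lhs i = atom (lhsSym i) (lhsArgs i)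

open RewriteSystem public

record IsPropRewriteSystem (R : RewriteSystem) : Set where
  field
    fv⊆ : ∀ i x → FreeF x (rhs R i) → FreeF x (lhs R i)
    leftLinear : ∀ i x → occTs x (lhsArgs R i) ≤ 1
    nonOverlapping : ∀ i j → _≢_ {A = Formula × Formula} (lhs R i , rhs R i) (lhs R j , rhs R j) →
                     ∀ σ τ → substF σ (lhs R i) ≢ substF τ (lhs R j)

data Step (R : RewriteSystem) : Formula → Formula → Set where
  root : ∀ i σ → Step R (substF σ (lhs R i)) (substF σ (rhs R i))
  ⇒l : ∀ {A A' B} → Step R A A' → Step R (A ⇒ B) (A' ⇒ B)
  ⇒r : ∀ {A B B'} → Step R B B' → Step R (A ⇒ B) (A ⇒ B')
  ∧l : ∀ {A A' B} → Step R A A' → Step R (A ∧ B) (A' ∧ B)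
  ∧r : ∀ {A B B'} → Step R B B' → Step R (A ∧ B) (A ∧ B')
  ∨l : ∀ {A A' B} → Step R A A' → Step R (A ∨ B) (A' ∨ B)
  ∨r : ∀ {A B B'} → Step R B B' → Step R (A ∨ B) (A ∨ B')
  allF : ∀ {A A'} → Step R A A' → Step R (allF A) (allF A')
  exF : ∀ {A A'} → Step R A A' → Step R (exF A) (exF A')

_⊢_≡ᴿ_ : RewriteSystem → Formula → Formula → Set
R ⊢ A ≡ᴿ B = EqClosure (Step R) A B

data LK (R : RewriteSystem) : List Formula → List Formula → Set where
  ax : ∀ {A B} → R ⊢ A ≡ᴿ B → LK R [ A ] [ B ]
  cut : ∀ {Γ Δ A B} → R ⊢ A ≡ᴿ B → LK R Γ (A ∷ Δ) → LK R (B ∷ Γ) Δ → LK R Γ Δ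
  exL : ∀ {Γ Γ' Δ} → Γ ↭ Γ' → LK R Γ Δ → LK R Γ' Δ
  exR : ∀ {Γ Δ Δ'} → Δ ↭ Δ' → LK R Γ Δ → LK R Γ Δ'
  wkL : ∀ {Γ Δ A} → LK R Γ Δ → LK R (A ∷ Γ) Δ
  wkR : ∀ {Γ Δ A} → LK R Γ Δ → LK R Γ (A ∷ Δ)
  ctrL : ∀ {Γ Δ A B C} → R ⊢ C ≡ᴿ A → R ⊢ C ≡ᴿ B →
         LK R (A ∷ B ∷ Γ) Δ → LK R (C ∷ Γ) Δ
  ctrR : ∀ {Γ Δ A B C} → R ⊢ C ≡ᴿ A → R ⊢ C ≡ᴿ B →
         LK R Γ (A ∷ B ∷ Δ) → LK R Γ (C ∷ Δ)
  ⊥L : ∀ {C} → R ⊢ C ≡ᴿ ⊥ᶠ → LK R [ C ] []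
  ⊤R : ∀ {C} → R ⊢ C ≡ᴿ ⊤ᶠ → LK R [] [ C ]
  ∧L : ∀ {Γ Δ A B C} → R ⊢ C ≡ᴿ (A ∧ B) →
       LK R (A ∷ B ∷ Γ) Δ → LK R (C ∷ Γ) Δ
  ∧R : ∀ {Γ Δ A B C} → R ⊢ C ≡ᴿ (A ∧ B) →
       LK R Γ (A ∷ Δ) → LK R Γ (B ∷ Δ) → LK R Γ (C ∷ Δ)
  ∨L : ∀ {Γ Δ A B C} → R ⊢ C ≡ᴿ (A ∨ B) →
       LK R (A ∷ Γ) Δ → LK R (B ∷ Γ) Δ → LK R (C ∷ Γ) Δ
  ∨R : ∀ {Γ Δ A B C} → R ⊢ C ≡ᴿ (A ∨ B) →
       LK R Γ (A ∷ B ∷ Δ) → LK R Γ (C ∷ Δ)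
  ⇒L : ∀ {Γ Δ A B C} → R ⊢ C ≡ᴿ (A ⇒ B) →
       LK R Γ (A ∷ Δ) → LK R (B ∷ Γ) Δ → LK R (C ∷ Γ) Δ
  ⇒R : ∀ {Γ Δ A B C} → R ⊢ C ≡ᴿ (A ⇒ B) →
       LK R (A ∷ Γ) (B ∷ Δ) → LK R Γ (C ∷ Δ)
  ∀L : ∀ {Γ Δ A C} (t : Term) → R ⊢ C ≡ᴿ allF A →
       LK R (inst A t ∷ Γ) Δ → LK R (C ∷ Γ) Δ
  -- eigenvariable = de Bruijn index 0, fresh since Γ, Δ are shifted
  ∀R : ∀ {Γ Δ A C} → R ⊢ C ≡ᴿ allF A →
       LK R (map shift Γ) (A ∷ map shift Δ) → LK R Γ (C ∷ Δ)
  ∃L : ∀ {Γ Δ A C} → R ⊢ C ≡ᴿ exF A →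
       LK R (A ∷ map shift Γ) (map shift Δ) → LK R (C ∷ Γ) Δ
  ∃R : ∀ {Γ Δ A C} (t : Term) → R ⊢ C ≡ᴿ exF A →
       LK R Γ (inst A t ∷ Δ) → LK R Γ (C ∷ Δ)

-- Intuitionistic sequent calculus modulo R (at most one formula on the
-- right, represented by Maybe Formula)

data LJ (R : RewriteSystem) : List Formula → Maybe Formula → Set where
  ax : ∀ {A B} → R ⊢ A ≡ᴿ B → LJ R [ A ] (just B)
  cut : ∀ {Γ o A B} → R ⊢ A ≡ᴿ B → LJ R Γ (just A) → LJ R (B ∷ Γ) o → LJ R Γ o
  exL : ∀ {Γ Γ' o} → Γ ↭ Γ' → LJ R Γ o → LJ R Γ' o
  wkL : ∀ {Γ o A} → LJ R Γ o → LJ R (A ∷ Γ) o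
  wkR : ∀ {Γ A} → LJ R Γ nothing → LJ R Γ (just A)
  ctrL : ∀ {Γ o A B C} → R ⊢ C ≡ᴿ A → R ⊢ C ≡ᴿ B →
         LJ R (A ∷ B ∷ Γ) o → LJ R (C ∷ Γ) o
  ⊥L : ∀ {C} → R ⊢ C ≡ᴿ ⊥ᶠ → LJ R [ C ] nothing
  ⊤R : ∀ {C} → R ⊢ C ≡ᴿ ⊤ᶠ → LJ R [] (just C)
  ∧L : ∀ {Γ o A B C} → R ⊢ C ≡ᴿ (A ∧ B) →
       LJ R (A ∷ B ∷ Γ) o → LJ R (C ∷ Γ) o
  ∧R : ∀ {Γ A B C} → R ⊢ C ≡ᴿ (A ∧ B) →
       LJ R Γ (just A) → LJ R Γ (just B) → LJ R Γ (just C)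
  ∨L : ∀ {Γ o A B C} → R ⊢ C ≡ᴿ (A ∨ B) →
       LJ R (A ∷ Γ) o → LJ R (B ∷ Γ) o → LJ R (C ∷ Γ) o
  ∨R₁ : ∀ {Γ A B C} → R ⊢ C ≡ᴿ (A ∨ B) → LJ R Γ (just A) → LJ R Γ (just C)
  ∨R₂ : ∀ {Γ A B C} → R ⊢ C ≡ᴿ (A ∨ B) → LJ R Γ (just B) → LJ R Γ (just C)
  ⇒L : ∀ {Γ o A B C} → R ⊢ C ≡ᴿ (A ⇒ B) →
       LJ R Γ (just A) → LJ R (B ∷ Γ) o → LJ R (C ∷ Γ) o
  ⇒R : ∀ {Γ A B C} → R ⊢ C ≡ᴿ (A ⇒ B) →
       LJ R (A ∷ Γ) (just B) → LJ R Γ (just C)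
  ∀L : ∀ {Γ o A C} (t : Term) → R ⊢ C ≡ᴿ allF A →
       LJ R (inst A t ∷ Γ) o → LJ R (C ∷ Γ) o
  ∀R : ∀ {Γ A C} → R ⊢ C ≡ᴿ allF A →
       LJ R (map shift Γ) (just A) → LJ R Γ (just C)
  ∃L : ∀ {Γ o A C} → R ⊢ C ≡ᴿ exF A →
       LJ R (A ∷ map shift Γ) (mapMaybe shift o) → LJ R (C ∷ Γ) o
  ∃R : ∀ {Γ A C} (t : Term) → R ⊢ C ≡ᴿ exF A →
       LJ R Γ (just (inst A t)) → LJ R Γ (just C)

-- A-translation (A is used literally under binders; it is assumed closed)

¬[_]_ : Formula → Formula → Formula
¬[ A ] X = (X ⇒ A) ⇒ A

_^_ : Formula → Formula → Formula
atom p ts ^ A = atom p ts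
⊤ᶠ ^ A = ⊤ᶠ
⊥ᶠ ^ A = ⊥ᶠ
(B ⇒ C) ^ A = (¬[ A ] (B ^ A)) ⇒ (¬[ A ] (C ^ A))
(B ∧ C) ^ A = (¬[ A ] (B ^ A)) ∧ (¬[ A ] (C ^ A))
(B ∨ C) ^ A = (¬[ A ] (B ^ A)) ∨ (¬[ A ] (C ^ A))
allF B ^ A = allF (¬[ A ] (B ^ A))
exF B ^ A = exF (¬[ A ] (B ^ A))

_^ᴿ_ : RewriteSystem → Formula → RewriteSystem
R ^ᴿ A = record
  { Idx = Idx R
  ; lhsSym = lhsSym R
  ; lhsArgs = lhsArgs R
  ; rhs = λ i → rhs R i ^ A
  }

SymbolDisjoint : Formula → RewriteSystem → Set
SymbolDisjoint A R =
  (∀ f → FunF f A → ∀ i → ¬ (FunF f (lhs R i) ⊎ FunF f (rhs R i))) ×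
  (∀ p → PredF p A → ∀ i → ¬ (PredF p (lhs R i) ⊎ PredF p (rhs R i)))

-- A classical proof is translated rule by rule.  A formula D on the right of
-- a classical sequent becomes the hypothesis D^A ⇒ A, so every translated
-- sequent has the single conclusion A and is intuitionistically acceptable.
-- Right rules are simulated by proving (a congruent copy of) D^A and applying
-- D^A ⇒ A; left rules by peeling the double negations ¬[A] that the
-- translation inserts around each immediate subformula, which is possible
-- precisely because the conclusion is A.  Congruence steps survive the
-- translation since the left-hand sides of rules are atomic and atoms are
-- fixed by it, and quantifier rules survive since A, being closed, is
-- untouched by substitution and renaming.
module Submission where

open import Defs
open import Data.List using (List; map; _++_; []; _∷_; [_])
open import Data.List.Properties using (map-++)
open import Data.Maybe using (just)
open import Data.Nat using (zero; suc)
open import Data.Empty using (⊥-elim)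
open import Relation.Binary.PropositionalEquality
  using (_≡_; refl; sym; trans; cong; cong₂; subst)
import Relation.Binary.Construct.Closure.Equivalence as EqClosure
open import Relation.Binary.Construct.Closure.ReflexiveTransitive using (ε)
open import Data.List.Relation.Binary.Permutation.Propositional
  using (_↭_; ↭-sym; ↭-trans; prep; swap)
  renaming (refl to ↭-refl)
import Data.List.Relation.Binary.Permutation.Propositional.Properties as ↭

mutual
  substT-id : ∀ t σ → (∀ x → FreeT x t → σ x ≡ var x) → substT σ t ≡ t
  substT-id (var x) σ h = h x here
  substT-id (fun f ts) σ h = cong (fun f) (substTs-id ts σ (λ x p → h x (inFun p)))

  substTs-id : ∀ ts σ → (∀ x → FreeTs x ts → σ x ≡ var x) → substTs σ ts ≡ ts
  substTs-id [] σ h = refl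
  substTs-id (t ∷ ts) σ h =
    cong₂ _∷_ (substT-id t σ (λ x p → h x (hd p))) (substTs-id ts σ (λ x p → h x (tl p)))

mutual
  renT-id : ∀ t ρ → (∀ x → FreeT x t → ρ x ≡ x) → renT ρ t ≡ t
  renT-id (var x) ρ h = cong var (h x here)
  renT-id (fun f ts) ρ h = cong (fun f) (renTs-id ts ρ (λ x p → h x (inFun p)))

  renTs-id : ∀ ts ρ → (∀ x → FreeTs x ts → ρ x ≡ x) → renTs ρ ts ≡ ts
  renTs-id [] ρ h = refl
  renTs-id (t ∷ ts) ρ h =
    cong₂ _∷_ (renT-id t ρ (λ x p → h x (hd p))) (renTs-id ts ρ (λ x p → h x (tl p)))

substF-id : ∀ B σ → (∀ x → FreeF x B → σ x ≡ var x) → substF σ B ≡ B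
substF-id (atom p ts) σ h = cong (atom p) (substTs-id ts σ (λ x q → h x (atom q)))
substF-id ⊤ᶠ σ h = refl
substF-id ⊥ᶠ σ h = refl
substF-id (B ⇒ C) σ h = cong₂ _⇒_ (substF-id B σ (λ x q → h x (⇒l q))) (substF-id C σ (λ x q → h x (⇒r q)))
substF-id (B ∧ C) σ h = cong₂ _∧_ (substF-id B σ (λ x q → h x (∧l q))) (substF-id C σ (λ x q → h x (∧r q)))
substF-id (B ∨ C) σ h = cong₂ _∨_ (substF-id B σ (λ x q → h x (∨l q))) (substF-id C σ (λ x q → h x (∨r q)))
substF-id (allF B) σ h =
  cong allF (substF-id B (lift σ) λ { zero q → refl ; (suc x) q → cong (renT suc) (h x (allF q)) })
substF-id (exF B) σ h =
  cong exF (substF-id B (lift σ) λ { zero q → refl ; (suc x) q → cong (renT suc) (h x (exF q)) })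

renF-id : ∀ B ρ → (∀ x → FreeF x B → ρ x ≡ x) → renF ρ B ≡ B
renF-id (atom p ts) ρ h = cong (atom p) (renTs-id ts ρ (λ x q → h x (atom q)))
renF-id ⊤ᶠ ρ h = refl
renF-id ⊥ᶠ ρ h = refl
renF-id (B ⇒ C) ρ h = cong₂ _⇒_ (renF-id B ρ (λ x q → h x (⇒l q))) (renF-id C ρ (λ x q → h x (⇒r q)))
renF-id (B ∧ C) ρ h = cong₂ _∧_ (renF-id B ρ (λ x q → h x (∧l q))) (renF-id C ρ (λ x q → h x (∧r q)))
renF-id (B ∨ C) ρ h = cong₂ _∨_ (renF-id B ρ (λ x q → h x (∨l q))) (renF-id C ρ (λ x q → h x (∨r q)))
renF-id (allF B) ρ h =
  cong allF (renF-id B (ext ρ) λ { zero q → refl ; (suc x) q → cong suc (h x (allF q)) })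
renF-id (exF B) ρ h =
  cong exF (renF-id B (ext ρ) λ { zero q → refl ; (suc x) q → cong suc (h x (exF q)) })

substF-closed : ∀ {B} → Closed B → ∀ σ → substF σ B ≡ B
substF-closed closed σ = substF-id _ σ (λ x p → ⊥-elim (closed x p))

renF-closed : ∀ {B} → Closed B → ∀ ρ → renF ρ B ≡ B
renF-closed closed ρ = renF-id _ ρ (λ x p → ⊥-elim (closed x p))

module LJ-Properties {R : RewriteSystem} where

  wkL-++ : ∀ Δ {Γ o} → LJ R Γ o → LJ R (Δ ++ Γ) o
  wkL-++ [] d = d
  wkL-++ (_ ∷ Δ) d = wkL (wkL-++ Δ d)

  assumption : ∀ X Γ → LJ R (X ∷ Γ) (just X)
  assumption X Γ = exL (↭.++-comm Γ [ X ]) (wkL-++ Γ (ax ε))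

  replace-hyp : ∀ {X Y Γ o} → LJ R (Y ∷ Γ) (just X) → LJ R (X ∷ Γ) o → LJ R (Y ∷ Γ) o
  replace-hyp d e = cut ε d (exL (swap _ _ ↭-refl) (wkL e))

  ¬[]-intro : ∀ {A} X Γ → LJ R (X ∷ Γ) (just (¬[ A ] X))
  ¬[]-intro {A} X Γ = ⇒R ε (⇒L ε (assumption X Γ) (assumption A (X ∷ Γ)))

  ¬[]-elimL : ∀ {A X Γ} → LJ R (X ∷ Γ) (just A) → LJ R (¬[ A ] X ∷ Γ) (just A)
  ¬[]-elimL {A} {Γ = Γ} d = ⇒L ε (⇒R ε d) (assumption A Γ)

≡ᴿ-⇒ˡ : ∀ {R X Y Z} → R ⊢ X ≡ᴿ Y → R ⊢ (X ⇒ Z) ≡ᴿ (Y ⇒ Z)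
≡ᴿ-⇒ˡ = EqClosure.gmap _ ⇒l

module ATranslation {A : Formula} (closed : Closed A) where

  ¬ᴬ_ : Formula → Formula
  ¬ᴬ X = (X ^ A) ⇒ A

  antecedent : List Formula → List Formula → List Formula
  antecedent Γ Δ = map (_^ A) Γ ++ map ¬ᴬ_ Δ

  substF-¬[] : ∀ σ X → substF σ (¬[ A ] X) ≡ ¬[ A ] substF σ X
  substF-¬[] σ X = cong₂ (λ a b → (substF σ X ⇒ a) ⇒ b) (substF-closed closed σ) (substF-closed closed σ)

  renF-¬[] : ∀ ρ X → renF ρ (¬[ A ] X) ≡ ¬[ A ] renF ρ X
  renF-¬[] ρ X = cong₂ (λ a b → (renF ρ X ⇒ a) ⇒ b) (renF-closed closed ρ) (renF-closed closed ρ)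

  mutual
    substF-^ : ∀ σ B → substF σ (B ^ A) ≡ substF σ B ^ A
    substF-^ σ (atom p ts) = refl
    substF-^ σ ⊤ᶠ = refl
    substF-^ σ ⊥ᶠ = refl
    substF-^ σ (B ⇒ C) = cong₂ _⇒_ (substF-¬[]^ σ B) (substF-¬[]^ σ C)
    substF-^ σ (B ∧ C) = cong₂ _∧_ (substF-¬[]^ σ B) (substF-¬[]^ σ C)
    substF-^ σ (B ∨ C) = cong₂ _∨_ (substF-¬[]^ σ B) (substF-¬[]^ σ C)
    substF-^ σ (allF B) = cong allF (substF-¬[]^ (lift σ) B)
    substF-^ σ (exF B) = cong exF (substF-¬[]^ (lift σ) B)

    substF-¬[]^ : ∀ σ B → substF σ (¬[ A ] (B ^ A)) ≡ ¬[ A ] (substF σ B ^ A)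
    substF-¬[]^ σ B = trans (substF-¬[] σ (B ^ A)) (cong ¬[ A ]_ (substF-^ σ B))

  mutual
    renF-^ : ∀ ρ B → renF ρ (B ^ A) ≡ renF ρ B ^ A
    renF-^ ρ (atom p ts) = refl
    renF-^ ρ ⊤ᶠ = refl
    renF-^ ρ ⊥ᶠ = refl
    renF-^ ρ (B ⇒ C) = cong₂ _⇒_ (renF-¬[]^ ρ B) (renF-¬[]^ ρ C)
    renF-^ ρ (B ∧ C) = cong₂ _∧_ (renF-¬[]^ ρ B) (renF-¬[]^ ρ C)
    renF-^ ρ (B ∨ C) = cong₂ _∨_ (renF-¬[]^ ρ B) (renF-¬[]^ ρ C)
    renF-^ ρ (allF B) = cong allF (renF-¬[]^ (ext ρ) B)
    renF-^ ρ (exF B) = cong exF (renF-¬[]^ (ext ρ) B)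

    renF-¬[]^ : ∀ ρ B → renF ρ (¬[ A ] (B ^ A)) ≡ ¬[ A ] (renF ρ B ^ A)
    renF-¬[]^ ρ B = trans (renF-¬[] ρ (B ^ A)) (cong ¬[ A ]_ (renF-^ ρ B))

  inst-¬[]^ : ∀ B t → inst (¬[ A ] (B ^ A)) t ≡ ¬[ A ] (inst B t ^ A)
  inst-¬[]^ B t = substF-¬[]^ (single t) B

  shift-antecedent : ∀ Γ Δ → map shift (antecedent Γ Δ) ≡ antecedent (map shift Γ) (map shift Δ)
  shift-antecedent Γ Δ =
    trans (map-++ shift (map (_^ A) Γ) (map ¬ᴬ_ Δ)) (cong₂ _++_ (shift-^ Γ) (shift-¬ᴬ Δ))
    where
    shift-^ : ∀ Γ → map shift (map (_^ A) Γ) ≡ map (_^ A) (map shift Γ)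
    shift-^ [] = refl
    shift-^ (X ∷ Γ) = cong₂ _∷_ (renF-^ suc X) (shift-^ Γ)

    shift-¬ᴬ : ∀ Δ → map shift (map ¬ᴬ_ Δ) ≡ map ¬ᴬ_ (map shift Δ)
    shift-¬ᴬ [] = refl
    shift-¬ᴬ (X ∷ Δ) = cong₂ _∷_ (cong₂ _⇒_ (renF-^ suc X) (renF-closed closed suc)) (shift-¬ᴬ Δ)

  module _ {R : RewriteSystem} where
    open LJ-Properties {R ^ᴿ A}

    Step-^ : ∀ {X Y} → Step R X Y → Step (R ^ᴿ A) (X ^ A) (Y ^ A)
    Step-^ (root i σ) =
      subst (Step (R ^ᴿ A) (substF σ (lhs R i))) (substF-^ σ (rhs R i)) (root i σ)
    Step-^ (⇒l s) = ⇒l (⇒l (⇒l (Step-^ s)))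
    Step-^ (⇒r s) = ⇒r (⇒l (⇒l (Step-^ s)))
    Step-^ (∧l s) = ∧l (⇒l (⇒l (Step-^ s)))
    Step-^ (∧r s) = ∧r (⇒l (⇒l (Step-^ s)))
    Step-^ (∨l s) = ∨l (⇒l (⇒l (Step-^ s)))
    Step-^ (∨r s) = ∨r (⇒l (⇒l (Step-^ s)))
    Step-^ (allF s) = allF (⇒l (⇒l (Step-^ s)))
    Step-^ (exF s) = exF (⇒l (⇒l (Step-^ s)))

    ≡ᴿ-^ : ∀ {X Y} → R ⊢ X ≡ᴿ Y → (R ^ᴿ A) ⊢ (X ^ A) ≡ᴿ (Y ^ A)
    ≡ᴿ-^ = EqClosure.gmap (_^ A) Step-^

    focus : ∀ Γ Δ C → antecedent Γ (C ∷ Δ) ↭ ¬ᴬ C ∷ antecedent Γ Δ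
    focus Γ Δ C = ↭.shift (¬ᴬ C) (map (_^ A) Γ) (map ¬ᴬ_ Δ)

    focusR : ∀ {Γ Δ C o} → LJ (R ^ᴿ A) (¬ᴬ C ∷ antecedent Γ Δ) o → LJ (R ^ᴿ A) (antecedent Γ (C ∷ Δ)) o
    focusR {Γ} {Δ} {C} = exL (↭-sym (focus Γ Δ C))

    unfocusR : ∀ {Γ Δ C o} → LJ (R ^ᴿ A) (antecedent Γ (C ∷ Δ)) o → LJ (R ^ᴿ A) (¬ᴬ C ∷ antecedent Γ Δ) o
    unfocusR {Γ} {Δ} {C} = exL (focus Γ Δ C)

    unfocusR₂ : ∀ {Γ Δ B C o} →
      LJ (R ^ᴿ A) (antecedent Γ (B ∷ C ∷ Δ)) o → LJ (R ^ᴿ A) (¬ᴬ B ∷ ¬ᴬ C ∷ antecedent Γ Δ) o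
    unfocusR₂ {Γ} {Δ} {B} {C} = exL (↭-trans (focus Γ (C ∷ Δ) B) (prep _ (focus Γ Δ C)))

    ¬[]-introR : ∀ {Γ Δ B} → LJ (R ^ᴿ A) (antecedent Γ (B ∷ Δ)) (just A) →
      LJ (R ^ᴿ A) (antecedent Γ Δ) (just (¬[ A ] (B ^ A)))
    ¬[]-introR d = ⇒R ε (unfocusR d)

    apply-¬ᴬ : ∀ {Γ Δ C X} → R ⊢ C ≡ᴿ X → LJ (R ^ᴿ A) (antecedent Γ Δ) (just (X ^ A)) →
      LJ (R ^ᴿ A) (antecedent Γ (C ∷ Δ)) (just A)
    apply-¬ᴬ e d = focusR (⇒L (≡ᴿ-⇒ˡ (≡ᴿ-^ e)) d (assumption A _))

    ¬ᴬ-∨⇒¬ᴬ₁ : ∀ {C X Y} Γ → R ⊢ C ≡ᴿ (X ∨ Y) → LJ (R ^ᴿ A) (¬ᴬ C ∷ Γ) (just (¬ᴬ X))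
    ¬ᴬ-∨⇒¬ᴬ₁ {X = X} Γ e =
      ⇒R ε (exL (swap _ _ ↭-refl) (⇒L (≡ᴿ-⇒ˡ (≡ᴿ-^ e)) (∨R₁ ε (¬[]-intro (X ^ A) Γ)) (assumption A _)))

    ¬ᴬ-∨⇒¬ᴬ₂ : ∀ {C X Y} Γ → R ⊢ C ≡ᴿ (X ∨ Y) → LJ (R ^ᴿ A) (¬ᴬ C ∷ Γ) (just (¬ᴬ Y))
    ¬ᴬ-∨⇒¬ᴬ₂ {Y = Y} Γ e =
      ⇒R ε (exL (swap _ _ ↭-refl) (⇒L (≡ᴿ-⇒ˡ (≡ᴿ-^ e)) (∨R₂ ε (¬[]-intro (Y ^ A) Γ)) (assumption A _)))

    LK⇒LJ : ∀ {Γ Δ} → LK R Γ Δ → LJ (R ^ᴿ A) (antecedent Γ Δ) (just A)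
    LK⇒LJ (ax e) = apply-¬ᴬ {Γ = [ _ ]} {Δ = []} (EqClosure.symmetric _ e) (ax ε)
    LK⇒LJ (cut e d₁ d₂) = cut (≡ᴿ-⇒ˡ (EqClosure.symmetric _ (≡ᴿ-^ e))) (⇒R ε (LK⇒LJ d₂)) (unfocusR (LK⇒LJ d₁))
    LK⇒LJ {Δ = Δ} (exL p d) = exL (↭.++⁺ʳ (map ¬ᴬ_ Δ) (↭.map⁺ (_^ A) p)) (LK⇒LJ d)
    LK⇒LJ {Γ = Γ} (exR p d) = exL (↭.++⁺ˡ (map (_^ A) Γ) (↭.map⁺ ¬ᴬ_ p)) (LK⇒LJ d)
    LK⇒LJ (wkL d) = wkL (LK⇒LJ d)
    LK⇒LJ (wkR d) = focusR (wkL (LK⇒LJ d))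
    LK⇒LJ (ctrL e₁ e₂ d) = ctrL (≡ᴿ-^ e₁) (≡ᴿ-^ e₂) (LK⇒LJ d)
    LK⇒LJ (ctrR e₁ e₂ d) = focusR (ctrL (≡ᴿ-⇒ˡ (≡ᴿ-^ e₁)) (≡ᴿ-⇒ˡ (≡ᴿ-^ e₂)) (unfocusR₂ (LK⇒LJ d)))
    LK⇒LJ (⊥L e) = wkR (⊥L (≡ᴿ-^ e))
    LK⇒LJ (⊤R e) = apply-¬ᴬ {Γ = []} {Δ = []} e (⊤R ε)
    LK⇒LJ (∧L e d) =
      ∧L (≡ᴿ-^ e) (exL (swap _ _ ↭-refl) (¬[]-elimL (exL (swap _ _ ↭-refl) (¬[]-elimL (LK⇒LJ d)))))
    LK⇒LJ (∧R e d₁ d₂) = apply-¬ᴬ e (∧R ε (¬[]-introR (LK⇒LJ d₁)) (¬[]-introR (LK⇒LJ d₂)))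
    LK⇒LJ (∨L e d₁ d₂) = ∨L (≡ᴿ-^ e) (¬[]-elimL (LK⇒LJ d₁)) (¬[]-elimL (LK⇒LJ d₂))
    -- duplicate ¬ᴬ (X ∨ Y) and replace the copies by ¬ᴬ X and ¬ᴬ Y, which it entails
    LK⇒LJ (∨R e d) =
      focusR (ctrL ε ε
        (replace-hyp (¬ᴬ-∨⇒¬ᴬ₁ _ e) (exL (swap _ _ ↭-refl)
          (replace-hyp (¬ᴬ-∨⇒¬ᴬ₂ _ e) (exL (swap _ _ ↭-refl) (unfocusR₂ (LK⇒LJ d)))))))
    LK⇒LJ (⇒L e d₁ d₂) = ⇒L (≡ᴿ-^ e) (¬[]-introR (LK⇒LJ d₁)) (¬[]-elimL (LK⇒LJ d₂))
    LK⇒LJ {Γ} {_ ∷ Δ} (⇒R {B = B} e d) =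
      apply-¬ᴬ e (⇒R ε (⇒R ε (exL (swap _ _ ↭-refl)
        (¬[]-elimL (exL (prep _ (focus Γ Δ B)) (LK⇒LJ d))))))
    LK⇒LJ {_ ∷ Γ} {Δ} (∀L {A = B} t e d) =
      ∀L t (≡ᴿ-^ e) (subst (λ X → LJ (R ^ᴿ A) (X ∷ antecedent Γ Δ) (just A)) (sym (inst-¬[]^ B t))
        (¬[]-elimL (LK⇒LJ d)))
    LK⇒LJ {Γ} {_ ∷ Δ} (∀R e d) =
      apply-¬ᴬ e (∀R ε (⇒R ε
        (subst (λ L → LJ (R ^ᴿ A) (_ ∷ L) (just A)) (sym (shift-antecedent Γ Δ)) (unfocusR (LK⇒LJ d)))))
    LK⇒LJ {_ ∷ Γ} {Δ} (∃L e d) =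
      ∃L (≡ᴿ-^ e) (subst (LJ (R ^ᴿ A) _) (cong just (sym (renF-closed closed suc)))
        (subst (λ L → LJ (R ^ᴿ A) (_ ∷ L) (just A)) (sym (shift-antecedent Γ Δ)) (¬[]-elimL (LK⇒LJ d))))
    LK⇒LJ {Γ} {_ ∷ Δ} (∃R {A = B} t e d) =
      apply-¬ᴬ e (∃R t ε (subst (λ X → LJ (R ^ᴿ A) (antecedent Γ Δ) (just X)) (sym (inst-¬[]^ B t))
        (¬[]-introR (LK⇒LJ d))))

proposition9 : (R : RewriteSystem) → IsPropRewriteSystem R →
    (A : Formula) → Closed A → SymbolDisjoint A R →
    (Γ Δ : List Formula) → LK R Γ Δ →
    LJ (R ^ᴿ A) (map (_^ A) Γ ++ map (λ D → (D ^ A) ⇒ A) Δ) (just A)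
proposition9 R _ A closed _ Γ Δ = ATranslation.LK⇒LJ closed
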